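{- Let $\Gamma$ be a semicomplete multipartite commutative weakly distance-regular digraph and $T=\{q\mid(1,q-1)\in\tilde\partial(\Gamma)\}$. If $2\in T$, then $(s,t)\notin\tilde\partial(\Gamma)$ for all $s,t\geq 3$.
   Context: A digraph has a finite vertex set and arcs that are ordered pairs of distinct vertices. $\partial(x,y)$ is the length of a shortest directed path from $x$ to $y$; strongly connected means all are finite. $\tilde\partial(x,y)=(\partial(x,y),\partial(y,x))$, $\tilde\partial(\Gamma)$ the set of these pairs, $\Gamma_{\tilde i}=\{(x,y):\tilde\partial(x,y)=\tilde i\}$. A strongly connected $\Gamma$ is weakly distance-regular if its arc relation is not symmetric and for all $\tilde i,\tilde j,\tilde h\in\tilde\partial(\Gamma)$ the number $|\{z:(x,z)\in\Gamma_{\tilde i},(z,y)\in\Gamma_{\tilde j}\}|$ is the same for all $(x,y)\in\Gamma_{\tilde h}$; commutative if this number is symmetric in $\tilde i,\tilde j$. $\Gamma$ is semicomplete multipartite if its underlying graph ($x\sim y$ iff $(x,y)$ or $(y,x)$ is an arc) is a complete multipartite graph with at least 2 parts, each of size at least 2. -}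

module Defs where

open import Data.Nat using (ℕ; zero; suc; _≤_)
open import Data.Fin using (Fin)
open import Data.Product using (Σ; ∃; _×_; _,_)
open import Data.Sum using (_⊎_)
open import Data.List using (List; length)
open import Data.List.Membership.Propositional using (_∈_)
open import Data.List.Relation.Unary.Unique.Propositional using (Unique)
open import Relation.Nullary using (¬_)
open import Relation.Binary.PropositionalEquality using (_≡_; _≢_)
open import Function.Bundles using (_⇔_)

record Digraph (n : ℕ) : Set₁ where
  field
    Arc       : Fin n → Fin n → Set
    irreflexive : ∀ x → ¬ Arc x x
open Digraph public

module _ {n : ℕ} (Γ : Digraph n) where

  data Walk : Fin n → Fin n → ℕ → Set where
    here : ∀ {x} → Walk x x zero
    step : ∀ {x y z k} → Arc Γ x y → Walk y z k → Walk x z (suc k)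

  IsDist : Fin n → Fin n → ℕ → Set
  IsDist x y d = Walk x y d × (∀ k → Walk x y k → d ≤ k)

  StronglyConnected : Set
  StronglyConnected = ∀ x y → ∃ λ d → IsDist x y d

  IsDist~ : Fin n → Fin n → ℕ × ℕ → Set
  IsDist~ x y (i , j) = IsDist x y i × IsDist y x j

  _∈∂~ : ℕ × ℕ → Set
  p ∈∂~ = ∃ λ x → ∃ λ y → IsDist~ x y p

  HasCount : (Fin n → Set) → ℕ → Set
  HasCount P c = Σ (List (Fin n)) λ zs →
    Unique zs × (∀ z → (z ∈ zs) ⇔ P z) × length zs ≡ c

  Inter : ℕ × ℕ → ℕ × ℕ → Fin n → Fin n → Fin n → Set
  Inter i j x y z = IsDist~ x z i × IsDist~ z y j

  ArcSymmetric : Set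
  ArcSymmetric = ∀ x y → Arc Γ x y → Arc Γ y x

  WeaklyDistanceRegular : Set
  WeaklyDistanceRegular =
    StronglyConnected × ¬ ArcSymmetric ×
    (∀ i j h → i ∈∂~ → j ∈∂~ → h ∈∂~ →
      ∃ λ c → ∀ x y → IsDist~ x y h → HasCount (Inter i j x y) c)

  Commutative : Set
  Commutative =
    ∀ i j h → i ∈∂~ → j ∈∂~ → h ∈∂~ →
    ∀ x y c c' → IsDist~ x y h →
    HasCount (Inter i j x y) c → HasCount (Inter j i x y) c' → c ≡ c'

  SemicompleteMultipartite : Set
  SemicompleteMultipartite =
    Σ ℕ λ m → Σ (Fin n → Fin m) λ part →
      (2 ≤ m) ×
      (∀ p → ∃ λ x → ∃ λ y → x ≢ y × part x ≡ p × part y ≡ p) ×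
      (∀ x y → (Arc Γ x y ⊎ Arc Γ y x) ⇔ (part x ≢ part y))

{-# OPTIONS --safe #-}
module Submission where

-- Two vertices x, y with ∂̃(x,y) = (s,t), s,t ≥ 3, are non-adjacent, hence lie
-- in the same part of the multipartition. A vertex z with ∂̃(x,z) = (1,1) lies
-- in another part, so it is also adjacent to y, and x → z → y or y → z → x is a
-- walk of length 2 between x and y: x has no such z. On the other hand the
-- number of such z is p^(0,0)_(1,1),(1,1), which weak distance-regularity makes
-- independent of x and which is positive because (1,1) ∈ ∂̃(Γ).

open import Defs
open import Data.Nat using (ℕ; _≤_; z≤n; s≤s)
open import Data.Nat.Properties using (<⇒≤; ≤⇒≯)
open import Data.Fin using (Fin; _≟_)
open import Data.Product using (∃; _,_; swap)
open import Data.Sum using (_⊎_; inj₁; inj₂)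
open import Data.List using (List; []; _∷_; length)
open import Data.List.Membership.Propositional using (_∈_)
open import Data.List.Relation.Unary.Any as Any using ()
open import Relation.Nullary using (¬_)
open import Relation.Nullary.Decidable using (decidable-stable)
open import Relation.Binary.PropositionalEquality using (_≡_; refl; trans)
open import Function.Bundles using (Equivalence)

module _ {n : ℕ} (Γ : Digraph n) where

  Adjacent : Fin n → Fin n → Set
  Adjacent x y = Arc Γ x y ⊎ Arc Γ y x

  IsDist-refl : ∀ x → IsDist Γ x x 0
  IsDist-refl x = here , λ _ _ → z≤n

  IsDist~-refl : ∀ x → IsDist~ Γ x x (0 , 0)
  IsDist~-refl x = IsDist-refl x , IsDist-refl x

  IsDist-1⇒Arc : ∀ {x y} → IsDist Γ x y 1 → Arc Γ x y
  IsDist-1⇒Arc (step a here , _) = a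

  Arc⇒dist≤1 : ∀ {x y d} → Arc Γ x y → IsDist Γ x y d → d ≤ 1
  Arc⇒dist≤1 xy (_ , minimal) = minimal 1 (step xy here)

  Arc-Arc⇒dist≤2 : ∀ {x y z d} → Arc Γ x z → Arc Γ z y → IsDist Γ x y d → d ≤ 2
  Arc-Arc⇒dist≤2 xz zy (_ , minimal) = minimal 2 (step xz (step zy here))

  2≤dist⇒¬Adjacent : ∀ {x y s t} → 2 ≤ s → 2 ≤ t → IsDist~ Γ x y (s , t) →
                     ¬ Adjacent x y
  2≤dist⇒¬Adjacent 2≤s _ (dxy , _) (inj₁ xy) = ≤⇒≯ (Arc⇒dist≤1 xy dxy) 2≤s
  2≤dist⇒¬Adjacent _ 2≤t (_ , dyx) (inj₂ yx) = ≤⇒≯ (Arc⇒dist≤1 yx dyx) 2≤t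

  HasCount-positive : ∀ {P c z} → HasCount Γ P c → P z → 1 ≤ c
  HasCount-positive {z = z} (zs , _ , iff , refl) pz =
    nonempty (Equivalence.from (iff z) pz)
    where
    nonempty : ∀ {xs : List (Fin n)} → z ∈ xs → 1 ≤ length xs
    nonempty {_ ∷ _} _ = s≤s z≤n

  HasCount-witness : ∀ {P c} → HasCount Γ P c → 1 ≤ c → ∃ P
  HasCount-witness (z ∷ _ , _ , iff , _) _ = z , Equivalence.to (iff z) (Any.here refl)
  HasCount-witness ([] , _ , _ , refl) ()

  ¬Adjacent-Adjacent⇒Adjacent : SemicompleteMultipartite Γ → ∀ {x y z} →
                                ¬ Adjacent x y → Adjacent x z → Adjacent y z
  ¬Adjacent-Adjacent⇒Adjacent (_ , part , _ , _ , adj) {x} {y} {z} ¬xy xz =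
    Equivalence.from (adj y z) y≁z
    where
    x≈y : part x ≡ part y
    x≈y = decidable-stable (part x ≟ part y) (λ x≉y → ¬xy (Equivalence.from (adj x y) x≉y))

    y≁z : ¬ part y ≡ part z
    y≁z y≈z = Equivalence.to (adj x z) xz (trans x≈y y≈z)

  far⇒¬digon : SemicompleteMultipartite Γ → ∀ {x y z s t} → 3 ≤ s → 3 ≤ t →
               IsDist~ Γ x y (s , t) → ¬ IsDist~ Γ x z (1 , 1)
  far⇒¬digon smp 3≤s 3≤t dxy@(dxy₁ , dyx₁) (dxz , dzx)
    with ¬Adjacent-Adjacent⇒Adjacent smp (2≤dist⇒¬Adjacent (<⇒≤ 3≤s) (<⇒≤ 3≤t) dxy)
                                         (inj₁ (IsDist-1⇒Arc dxz))
  ... | inj₁ yz = ≤⇒≯ (Arc-Arc⇒dist≤2 yz (IsDist-1⇒Arc dzx) dyx₁) 3≤t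
  ... | inj₂ zy = ≤⇒≯ (Arc-Arc⇒dist≤2 (IsDist-1⇒Arc dxz) zy dxy₁) 3≤s

  ∈∂~⇒realised-at-every-vertex : WeaklyDistanceRegular Γ → ∀ {a b} → _∈∂~ Γ (a , b) →
                                 ∀ x → ∃ λ z → IsDist~ Γ x z (a , b)
  ∈∂~⇒realised-at-every-vertex (_ , _ , wdr) {a} {b} ab@(u , v , duv) x
    with wdr (a , b) (b , a) (0 , 0) ab (v , u , swap duv) (x , x , IsDist~-refl x)
  ... | _ , count with HasCount-witness (count x x (IsDist~-refl x))
                         (HasCount-positive (count u u (IsDist~-refl u)) (duv , swap duv))
  ... | z , dxz , _ = z , dxz

lemma4p9 : ∀ {n} (Γ : Digraph n) →
    SemicompleteMultipartite Γ → WeaklyDistanceRegular Γ → Commutative Γ →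
    _∈∂~ Γ (1 , 1) →
    ∀ (s t : ℕ) → 3 ≤ s → 3 ≤ t → ¬ (_∈∂~ Γ (s , t))
lemma4p9 Γ smp wdr _ digon _ _ 3≤s 3≤t (x , y , dxy)
  with ∈∂~⇒realised-at-every-vertex Γ wdr digon x
... | _ , dxz = far⇒¬digon Γ smp 3≤s 3≤t dxy dxz
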